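{- Let $P_n$ be the path graph on $[n]$ with edges $(i,i+1)$, $i\in[n-1]$, and let $G$ be a leaf of the reduction tree $R_{P_n}^{\mathcal{O}}$. Let $b(G)=\prod_{a=1}^p\beta_{i_a}$, where $((i_a,j_a),(j_a,k_a))$, $a\in[p]$, are all the reductions on the path from $P_n$ to $G$ in $R_{P_n}^{\mathcal{O}}$ at which one goes to the middle child. Then $$b(G)=\prod_{i=1}^{n-1}\beta_i^{f_G(i)},$$ where $f_G(i)$ is the number of connected components of $G$ (as a graph on $[n]$) such that the shortest edge $e$ of $G$ for which the component lies entirely between the initial and end vertex of $e$ has initial vertex $i$.
   Context: Graphs are finite loopless multigraphs on $[n]$, edges $(i,j)$ with $i<j$ ($i$ initial, $j$ end vertex). Reduction on edges $a=(i,j)$, $b=(j,k)$, $i<j<k$, of a graph $H$ produces $H_1$ ($E(H)\setminus\{b\}\cup\{(i,k)\}$), $H_2$ ($E(H)\setminus\{a\}\cup\{(i,k)\}$), $H_3$ ($E(H)\setminus\{a,b\}\cup\{(i,k)\}$). A reduction tree of $G$ is a rooted tree of graphs with root $G$, each non-leaf node $H$ having three children from one reduction, the left $H_1$, middle $H_3$, right $H_2$; leaves are the graphs with no pair $(i,j),(j,k)$, $i<j<k$. Order $\mathcal{O}$: at a non-leaf node, take the smallest vertex $v$ having edges $(a,v)$, $a<v$, and $(v,b)$, $b>v$, and reduce on such edges with $a$ minimal and $b$ maximal; the resulting tree for the root $P_n$ is $R_{P_n}^{\mathcal{O}}$. $\beta_1,\dots,\beta_{n-1}$ are commuting indeterminates.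 -}

module Defs where

open import Data.Nat.Base using (ℕ; zero; suc; _∸_; _<_; _≤_; _≡ᵇ_; _<ᵇ_; _≤ᵇ_)
open import Data.Nat.Properties using (_≟_)
open import Data.Bool.Base using (Bool; true; false; _∧_; _∨_; if_then_else_)
open import Data.Product using (_×_; _,_; proj₁; proj₂; Σ; ∃; ∃-syntax)
open import Data.List.Base using (List; []; _∷_; map; upTo; length; filterᵇ; _++_)
open import Data.Bool.ListAction using (any; all)
open import Data.List.Membership.Propositional using (_∈_)
open import Relation.Nullary using (¬_; yes; no)
open import Data.Empty using (⊥)

-- Graphs: finite loopless multigraphs on [n] = {1,…,n}, given as a list
-- (multiset) of edges (i , j) with i < j.

Edge : Set
Edge = ℕ × ℕ

Graph : Set
Graph = List Edge

vertices : ℕ → List ℕ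
vertices n = map suc (upTo n)

pathGraph : ℕ → Graph
pathGraph n = map (λ i → (i , suc i)) (vertices (n ∸ 1))

_≡ᴱ_ : Edge → Edge → Bool
(a , b) ≡ᴱ (c , d) = (a ≡ᵇ c) ∧ (b ≡ᵇ d)

remove1 : Edge → Graph → Graph
remove1 e [] = []
remove1 e (x ∷ xs) = if e ≡ᴱ x then xs else x ∷ remove1 e xs

red₁ red₂ red₃ : Graph → ℕ → ℕ → ℕ → Graph
red₁ H i j k = (i , k) ∷ remove1 (j , k) H
red₂ H i j k = (i , k) ∷ remove1 (i , j) H
red₃ H i j k = (i , k) ∷ remove1 (i , j) (remove1 (j , k) H)

Reducible : Graph → ℕ → Set
Reducible H v = (∃[ a ] ((a , v) ∈ H × a < v)) × (∃[ b ] ((v , b) ∈ H × v < b))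

IsLeaf : Graph → Set
IsLeaf H = ∀ v → ¬ Reducible H v

-- the reduction chosen by the order 𝒪 at H is on (a , v), (v , b):
-- v is the smallest vertex with an incoming and an outgoing edge,
-- a is minimal and b is maximal among such edges at v.
OReduction : Graph → ℕ → ℕ → ℕ → Set
OReduction H a v b =
  ((a , v) ∈ H) × (a < v) × ((v , b) ∈ H) × (v < b)
  × (∀ w → w < v → ¬ Reducible H w)
  × (∀ a' → (a' , v) ∈ H → a' < v → a ≤ a')
  × (∀ b' → (v , b') ∈ H → v < b' → b' ≤ b)

-- OPath H G ms : G is a leaf of the subtree of R^𝒪 rooted at H, reached by
-- a root-to-leaf path; ms lists the initial vertices i_a of the reductions
-- ((i_a , j_a) , (j_a , k_a)) along the path at which one goes to the middle child.
data OPath : Graph → Graph → List ℕ → Set where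
  leaf  : ∀ {H} → IsLeaf H → OPath H H []
  left  : ∀ {H G ms a v b} → OReduction H a v b →
          OPath (red₁ H a v b) G ms → OPath H G ms
  mid   : ∀ {H G ms a v b} → OReduction H a v b →
          OPath (red₃ H a v b) G ms → OPath H G (a ∷ ms)
  right : ∀ {H G ms a v b} → OReduction H a v b →
          OPath (red₂ H a v b) G ms → OPath H G ms

-- exponent of β_i in b(G) = ∏_a β_{i_a}: number of occurrences of i in ms
count : ℕ → List ℕ → ℕ
count i ms = length (filterᵇ (λ x → i ≡ᵇ x) ms)

_∈ᵇ_ : ℕ → List ℕ → Bool
w ∈ᵇ S = any (λ s → s ≡ᵇ w) S

adjacent : Graph → ℕ → ℕ → Bool
adjacent G u w = any (λ e → ((u , w) ≡ᴱ e) ∨ ((w , u) ≡ᴱ e)) G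

grow : Graph → ℕ → List ℕ → List ℕ
grow G n S = S ++ filterᵇ (λ w → any (λ s → adjacent G s w) S) (vertices n)

iter : ℕ → (List ℕ → List ℕ) → List ℕ → List ℕ
iter zero    f S = S
iter (suc k) f S = iter k f (f S)

-- vertex set of the connected component of u (n rounds suffice on [n])
component : Graph → ℕ → ℕ → List ℕ
component G n u = iter n (grow G n) (u ∷ [])

isRep : Graph → ℕ → ℕ → Bool
isRep G n u = all (λ w → u ≤ᵇ w) (component G n u)

between : List ℕ → Edge → Bool
between C (a , b) = all (λ w → (a <ᵇ w) ∧ (w <ᵇ b)) C

edgeLength : Edge → ℕ
edgeLength (a , b) = b ∸ a

shortestAbove : Graph → List ℕ → ℕ → Bool
shortestAbove G C i =
  any (λ e → (proj₁ e ≡ᵇ i) ∧ all (λ e' → edgeLength e ≤ᵇ edgeLength e') above) above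
  where above = filterᵇ (between C) G

f : Graph → ℕ → ℕ → ℕ
f G n i = length (filterᵇ (λ u → isRep G n u ∧ shortestAbove G (component G n u) i) (vertices n))

module Submission where

-- The order 𝒪 keeps the graphs of R^𝒪 in a very rigid shape, recorded in the
-- invariant 'Shape': the edges form a noncrossing forest on [n], there is a
-- cursor c such that no vertex below c is reducible, and from c on the graph
-- is still the tail c, c+1, …, n of the path.  Consequently every reduction of
-- 𝒪 happens at (a , v), (v , v+1) with c ≤ v, and the three children again
-- have this shape.
--
-- With this description we show that the left
-- and right children have the same f as their parent, and that the middle
-- child adds exactly one counted component, namely the one of v, with i = a.
-- Since f of the path graph is 0, summing over the path gives the theorem.

open import Defs
open import Data.Nat.Base
open import Data.Nat.Properties
open import Data.Bool.Base using (Bool; true; false; _∧_; _∨_; T)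
open import Data.Bool.Properties using (T-∧; T-∨; T-≡)
open import Data.Bool.ListAction using (any; all)
open import Data.Product using (_×_; _,_; proj₁; proj₂; ∃-syntax)
open import Data.Sum using (_⊎_; inj₁; inj₂; map₂)
open import Data.List.Base using (List; []; _∷_; upTo; length; filterᵇ)
open import Data.List.Membership.Propositional using (_∈_; find; lose)
open import Data.List.Membership.Propositional.Properties
  using (∈-map⁺; ∈-map⁻; ∈-++⁺ˡ; ∈-++⁺ʳ; ∈-++⁻; ∈-upTo⁺; ∈-upTo⁻; ∈-filter⁺; ∈-filter⁻)
open import Data.List.Properties using (length-map; length-upTo; length-filter; filter-some)
open import Data.List.Relation.Unary.Any using (here; there)
open import Data.List.Relation.Unary.Any.Properties using (any⁺; any⁻)
import Data.List.Relation.Unary.All as All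
open import Data.List.Relation.Unary.All.Properties using (all⁺; all⁻; ¬All⇒Any¬)
open import Data.List.Relation.Unary.AllPairs using (_∷_)
open import Data.List.Relation.Unary.Unique.Propositional using (Unique)
import Data.List.Relation.Unary.Unique.Propositional.Properties as Unique
open import Data.Empty using (⊥; ⊥-elim)
open import Function.Base using (_∘_)
open import Function.Bundles using (Equivalence)
open import Relation.Nullary using (¬_; yes; no)
open import Relation.Nullary.Decidable using (T?)
open import Relation.Binary.Definitions using (tri<; tri≈; tri>)
open import Relation.Binary.PropositionalEquality
open import Data.List.Extrema.Nat using (min; argmin-sel; min≤xs)

T-∧-intro : ∀ {x y} → T x → T y → T (x ∧ y)
T-∧-intro p q = Equivalence.from T-∧ (p , q)

T-∧-elim : ∀ {x y} → T (x ∧ y) → T x × T y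
T-∧-elim {x} = Equivalence.to (T-∧ {x})

T-ext : ∀ {x y : Bool} → (T x → T y) → (T y → T x) → x ≡ y
T-ext {false} {false} _ _ = refl
T-ext {false} {true}  _ g = ⊥-elim (g _)
T-ext {true}  {false} f _ = ⊥-elim (f _)
T-ext {true}  {true}  _ _ = refl

¬T⇒false : ∀ {x} → ¬ T x → x ≡ false
¬T⇒false {false} _ = refl
¬T⇒false {true}  h = ⊥-elim (h _)

module _ {A : Set} (p : A → Bool) where

  any⇒∃ : ∀ xs → T (any p xs) → ∃[ x ] (x ∈ xs × T (p x))
  any⇒∃ xs h = find (any⁻ p xs h)

  ∃⇒any : ∀ {x} xs → x ∈ xs → T (p x) → T (any p xs)
  ∃⇒any _ x∈ px = any⁺ p (lose x∈ px)

  all⇒∀ : ∀ {x} xs → T (all p xs) → x ∈ xs → T (p x)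
  all⇒∀ xs h = All.lookup (all⁺ p xs h)

  ∀⇒all : ∀ xs → (∀ x → x ∈ xs → T (p x)) → T (all p xs)
  ∀⇒all xs h = all⁻ p (All.tabulate (h _))

  ∈-filterᵇ⁻ : ∀ xs {x} → x ∈ filterᵇ p xs → x ∈ xs × T (p x)
  ∈-filterᵇ⁻ _ = ∈-filter⁻ (T? ∘ p)

  ∈-filterᵇ⁺ : ∀ xs {x} → x ∈ xs → T (p x) → x ∈ filterᵇ p xs
  ∈-filterᵇ⁺ _ = ∈-filter⁺ (T? ∘ p)

≡ᴱ⇒≡ : ∀ {e e'} → T (e ≡ᴱ e') → e ≡ e'
≡ᴱ⇒≡ {a , b} {c , d} h =
  let a≡c , b≡d = T-∧-elim h in cong₂ _,_ (≡ᵇ⇒≡ a c a≡c) (≡ᵇ⇒≡ b d b≡d)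

≡⇒≡ᴱ : ∀ {e e'} → e ≡ e' → T (e ≡ᴱ e')
≡⇒≡ᴱ {a , b} refl = T-∧-intro (≡⇒≡ᵇ a a refl) (≡⇒≡ᵇ b b refl)

_≟ᴱ_ : (e e' : Edge) → e ≡ e' ⊎ e ≢ e'
(a , b) ≟ᴱ (c , d) with a ≟ c | b ≟ d
... | yes refl | yes refl = inj₁ refl
... | no a≢c   | _        = inj₂ λ { refl → a≢c refl }
... | yes _    | no b≢d   = inj₂ λ { refl → b≢d refl }

remove1-⊆ : ∀ e {e'} H → e' ∈ remove1 e H → e' ∈ H
remove1-⊆ e (x ∷ H) m with e ≡ᴱ x
... | true = there m
remove1-⊆ e (x ∷ H) (here refl) | false = here refl
remove1-⊆ e (x ∷ H) (there m)   | false = there (remove1-⊆ e H m)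

remove1-⊇ : ∀ e {e'} H → e' ∈ H → e' ≡ e ⊎ e' ∈ remove1 e H
remove1-⊇ e (x ∷ H) m with e ≡ᴱ x in eq
remove1-⊇ e (x ∷ H) (here refl) | true  = inj₁ (sym (≡ᴱ⇒≡ (subst T (sym eq) _)))
remove1-⊇ e (x ∷ H) (there m)   | true  = inj₂ m
remove1-⊇ e (x ∷ H) (here refl) | false = inj₂ (here refl)
remove1-⊇ e (x ∷ H) (there m)   | false with remove1-⊇ e H m
... | inj₁ e'≡e = inj₁ e'≡e
... | inj₂ m'   = inj₂ (there m')

remove1-⊇≢ : ∀ {e e'} H → e' ∈ H → e' ≢ e → e' ∈ remove1 e H
remove1-⊇≢ {e} H m e'≢e with remove1-⊇ e H m
... | inj₁ e'≡e = ⊥-elim (e'≢e e'≡e)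
... | inj₂ m'   = m'

remove1-head : ∀ e H → remove1 e (e ∷ H) ≡ H
remove1-head e H with e ≡ᴱ e in eq
... | true  = refl
... | false = ⊥-elim (subst T eq (≡⇒≡ᴱ {e} refl))

remove1-cons : ∀ e x H → e ≢ x → remove1 e (x ∷ H) ≡ x ∷ remove1 e H
remove1-cons e x H e≢x with e ≡ᴱ x in eq
... | true  = ⊥-elim (e≢x (≡ᴱ⇒≡ (subst T (sym eq) _)))
... | false = refl

remove1-comm : ∀ e e' H → remove1 e (remove1 e' H) ≡ remove1 e' (remove1 e H)
remove1-comm e e' [] = refl
remove1-comm e e' (x ∷ H) with e ≡ᴱ x in p | e' ≡ᴱ x in q
... | true  | true  = cong (λ z → remove1 z H)
                        (trans (≡ᴱ⇒≡ (subst T (sym p) _)) (sym (≡ᴱ⇒≡ (subst T (sym q) _))))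
... | true  | false rewrite p = refl
... | false | true  rewrite q = refl
... | false | false rewrite p | q = cong (x ∷_) (remove1-comm e e' H)

remove1-⊆-inner : ∀ e e' H {x} → x ∈ remove1 e (remove1 e' H) → x ∈ remove1 e H
remove1-⊆-inner e e' H m = remove1-⊆ e' (remove1 e H) (subst (_ ∈_) (remove1-comm e e' H) m)

∈-vertices⁺ : ∀ {n w} → 1 ≤ w → w ≤ n → w ∈ vertices n
∈-vertices⁺ {w = suc w} _ w≤n = ∈-map⁺ suc (∈-upTo⁺ w≤n)

∈-vertices⁻ : ∀ {n w} → w ∈ vertices n → 1 ≤ w × w ≤ n
∈-vertices⁻ m with ∈-map⁻ suc m
... | x , x∈ , refl = s≤s z≤n , ∈-upTo⁻ x∈

length-vertices : ∀ n → length (vertices n) ≡ n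
length-vertices n = trans (length-map suc (upTo n)) (length-upTo n)

unique-vertices : ∀ n → Unique (vertices n)
unique-vertices n = Unique.map⁺ suc-injective (Unique.upTo⁺ n)

module _ {A : Set} where

  filterᵇ-cong : ∀ (p q : A → Bool) xs → (∀ x → x ∈ xs → p x ≡ q x) →
                 filterᵇ p xs ≡ filterᵇ q xs
  filterᵇ-cong p q [] h = refl
  filterᵇ-cong p q (x ∷ xs) h
    with p x | q x | h x (here refl) | filterᵇ-cong p q xs (λ y m → h y (there m))
  ... | true  | .true  | refl | r = cong (x ∷_) r
  ... | false | .false | refl | r = r

  length-filterᵇ-suc : ∀ (p q : A → Bool) xs {x₀} → Unique xs → x₀ ∈ xs →
    q x₀ ≡ true → p x₀ ≡ false → (∀ x → x ∈ xs → x ≢ x₀ → p x ≡ q x) →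
    length (filterᵇ q xs) ≡ suc (length (filterᵇ p xs))
  length-filterᵇ-suc p q (x ∷ xs) (x∉ ∷ _) (here refl) qx px h
    with q x | p x | filterᵇ-cong p q xs (λ y m → h y (there m) (λ e → All.lookup x∉ m (sym e)))
  ... | true | false | r = cong (suc ∘ length) (sym r)
  length-filterᵇ-suc p q (x ∷ xs) (x∉ ∷ u) (there m) qx px h
    with p x | q x | h x (here refl) (λ e → All.lookup x∉ m e)
       | length-filterᵇ-suc p q xs u m qx px (λ y m' → h y (there m'))
  ... | true  | .true  | refl | r = cong suc r
  ... | false | .false | refl | r = r

  length-filterᵇ-≤ : ∀ (p q : A → Bool) xs → (∀ x → x ∈ xs → T (p x) → T (q x)) →
                     length (filterᵇ p xs) ≤ length (filterᵇ q xs)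
  length-filterᵇ-≤ p q [] h = z≤n
  length-filterᵇ-≤ p q (x ∷ xs) h with p x in ep | q x in eq
  ... | true  | true  = s≤s (length-filterᵇ-≤ p q xs λ y m → h y (there m))
  ... | false | true  = m≤n⇒m≤1+n (length-filterᵇ-≤ p q xs λ y m → h y (there m))
  ... | false | false = length-filterᵇ-≤ p q xs λ y m → h y (there m)
  ... | true  | false = ⊥-elim (subst T eq (h x (here refl) (subst T (sym ep) _)))

  length-filterᵇ-< : ∀ (p q : A → Bool) xs → (∀ x → x ∈ xs → T (p x) → T (q x)) →
    ∀ {x} → x ∈ xs → T (q x) → ¬ T (p x) → length (filterᵇ p xs) < length (filterᵇ q xs)
  length-filterᵇ-< p q (y ∷ xs) h (here refl) qx ¬px with p y in ep | q y
  ... | true  | _     = ⊥-elim (¬px _)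
  ... | false | false = ⊥-elim qx
  ... | false | true  = s≤s (length-filterᵇ-≤ p q xs λ z m → h z (there m))
  length-filterᵇ-< p q (y ∷ xs) h (there m) qx ¬px with p y in ep | q y in eq
  ... | true  | true  = s≤s (length-filterᵇ-< p q xs (λ z m → h z (there m)) m qx ¬px)
  ... | false | true  = m≤n⇒m≤1+n (length-filterᵇ-< p q xs (λ z m → h z (there m)) m qx ¬px)
  ... | false | false = length-filterᵇ-< p q xs (λ z m → h z (there m)) m qx ¬px
  ... | true  | false = ⊥-elim (subst T eq (h y (here refl) (subst T (sym ep) _)))

Adj : Graph → ℕ → ℕ → Set
Adj G y z = (y , z) ∈ G ⊎ (z , y) ∈ G

infixl 5 _▹_

data Walk (G : Graph) (x : ℕ) : ℕ → Set where
  []  : Walk G x x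
  _▹_ : ∀ {y z} → Walk G x y → Adj G y z → Walk G x z

edgeWalk : ∀ {G y z} → (y , z) ∈ G → Walk G y z
edgeWalk m = [] ▹ inj₁ m

_++ʷ_ : ∀ {G x y z} → Walk G x y → Walk G y z → Walk G x z
p ++ʷ []      = p
p ++ʷ (q ▹ a) = (p ++ʷ q) ▹ a

reverse : ∀ {G x y} → Walk G x y → Walk G y x
reverse []              = []
reverse (p ▹ inj₁ m) = ([] ▹ inj₂ m) ++ʷ reverse p
reverse (p ▹ inj₂ m) = ([] ▹ inj₁ m) ++ʷ reverse p

simulate : ∀ {G G'} → (∀ {y z} → (y , z) ∈ G → Walk G' y z) →
           ∀ {x w} → Walk G x w → Walk G' x w
simulate h []           = []
simulate h (p ▹ inj₁ m) = simulate h p ++ʷ h m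
simulate h (p ▹ inj₂ m) = simulate h p ++ʷ reverse (h m)

walk-mono : ∀ {G G'} → (∀ {e} → e ∈ G → e ∈ G') → ∀ {x y} → Walk G x y → Walk G' x y
walk-mono sub = simulate (edgeWalk ∘ sub)

walk-split : ∀ {G} e {x y} → Walk (e ∷ G) x y →
             Walk G x y ⊎ (Walk G x (proj₁ e) ⊎ Walk G x (proj₂ e))
walk-split e [] = inj₁ []
walk-split e (p ▹ a) with walk-split e p
... | inj₂ r = inj₂ r
walk-split e (p ▹ inj₁ (here refl)) | inj₁ q = inj₂ (inj₁ q)
walk-split e (p ▹ inj₁ (there m))   | inj₁ q = inj₁ (q ▹ inj₁ m)
walk-split e (p ▹ inj₂ (here refl)) | inj₁ q = inj₂ (inj₂ q)
walk-split e (p ▹ inj₂ (there m))   | inj₁ q = inj₁ (q ▹ inj₂ m)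

unitWalk : ∀ G k d → (∀ w → k ≤ w → w < k + d → (w , suc w) ∈ G) → Walk G k (k + d)
unitWalk G k zero    h rewrite +-identityʳ k = []
unitWalk G k (suc d) h rewrite +-suc k d =
  unitWalk G k d (λ w k≤w w<k+d → h w k≤w (m<n⇒m<1+n w<k+d)) ▹ inj₁ (h (k + d) (m≤m+n k d) ≤-refl)

unitPath : ∀ G {k n} → k ≤ n → (∀ w → k ≤ w → w < n → (w , suc w) ∈ G) → Walk G k n
unitPath G {k} {n} k≤n h =
  subst (Walk G k) (m+[n∸m]≡n k≤n)
        (unitWalk G k (n ∸ k) λ w k≤w w<n → h w k≤w (subst (w <_) (m+[n∸m]≡n k≤n) w<n))

-- Components are the sets of reachable vertices

adjacent⇒Adj : ∀ {G u w} → T (adjacent G u w) → Adj G u w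
adjacent⇒Adj {G} {u} {w} h with any⇒∃ (λ e → ((u , w) ≡ᴱ e) ∨ ((w , u) ≡ᴱ e)) G h
... | e , e∈ , t with Equivalence.to (T-∨ {(u , w) ≡ᴱ e}) t
... | inj₁ uw≡e = inj₁ (subst (_∈ G) (sym (≡ᴱ⇒≡ uw≡e)) e∈)
... | inj₂ wu≡e = inj₂ (subst (_∈ G) (sym (≡ᴱ⇒≡ {w , u} wu≡e)) e∈)

Adj⇒adjacent : ∀ {G u w} → Adj G u w → T (adjacent G u w)
Adj⇒adjacent {G} {u} {w} (inj₁ m) =
  ∃⇒any (λ e → ((u , w) ≡ᴱ e) ∨ ((w , u) ≡ᴱ e)) G m
        (Equivalence.from T-∨ (inj₁ (≡⇒≡ᴱ {u , w} refl)))
Adj⇒adjacent {G} {u} {w} (inj₂ m) =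
  ∃⇒any (λ e → ((u , w) ≡ᴱ e) ∨ ((w , u) ≡ᴱ e)) G m
        (Equivalence.from (T-∨ {(u , w) ≡ᴱ (w , u)}) (inj₂ (≡⇒≡ᴱ {w , u} refl)))

∈ᵇ⇒∈ : ∀ {w S} → T (w ∈ᵇ S) → w ∈ S
∈ᵇ⇒∈ {w} {S} h with any⇒∃ (λ s → s ≡ᵇ w) S h
... | s , s∈ , s≡w = subst (_∈ S) (≡ᵇ⇒≡ s w s≡w) s∈

∈⇒∈ᵇ : ∀ {w S} → w ∈ S → T (w ∈ᵇ S)
∈⇒∈ᵇ {w} {S} m = ∃⇒any (λ s → s ≡ᵇ w) S m (≡⇒≡ᵇ w w refl)

OnVertices : Graph → ℕ → Set
OnVertices G n = ∀ {x y} → (x , y) ∈ G → x ∈ vertices n × y ∈ vertices n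

Closed : Graph → ℕ → List ℕ → Set
Closed G n S = ∀ {w} → w ∈ grow G n S → w ∈ S

module Components (G : Graph) (n : ℕ) where

  newVertex : List ℕ → ℕ → Bool
  newVertex S w = any (λ s → adjacent G s w) S

  grow-⊇ : ∀ S {w} → w ∈ S → w ∈ grow G n S
  grow-⊇ S = ∈-++⁺ˡ

  grow-mono : ∀ {S S'} → (∀ {w} → w ∈ S → w ∈ S') → ∀ {w} → w ∈ grow G n S → w ∈ grow G n S'
  grow-mono {S} {S'} sub {w} m with ∈-++⁻ S m
  ... | inj₁ m' = ∈-++⁺ˡ (sub m')
  ... | inj₂ m' with ∈-filterᵇ⁻ (newVertex S) (vertices n) m'
  ... | w∈ , t with any⇒∃ (λ s → adjacent G s w) S t
  ... | s , s∈ , a = ∈-++⁺ʳ S' (∈-filterᵇ⁺ (newVertex S') (vertices n) w∈ (∃⇒any (λ s → adjacent G s w) S' (sub s∈) a))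

  iterate-⊇ : ∀ k S {w} → w ∈ S → w ∈ iter k (grow G n) S
  iterate-⊇ zero    S m = m
  iterate-⊇ (suc k) S m = iterate-⊇ k (grow G n S) (grow-⊇ S m)

  iterate-suc : ∀ k S → iter (suc k) (grow G n) S ≡ grow G n (iter k (grow G n) S)
  iterate-suc zero    S = refl
  iterate-suc (suc k) S = iterate-suc k (grow G n S)

  component-sound : ∀ u {w} → w ∈ component G n u → Walk G u w
  component-sound u = go n (u ∷ []) λ { (here refl) → [] }
    where
      go : ∀ k S → (∀ {s} → s ∈ S → Walk G u s) → ∀ {w} → w ∈ iter k (grow G n) S → Walk G u w
      go zero    S h m = h m
      go (suc k) S h m = go k (grow G n S) grown m
        where
          grown : ∀ {w} → w ∈ grow G n S → Walk G u w
          grown {w} m' with ∈-++⁻ S m'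
          ... | inj₁ m'' = h m''
          ... | inj₂ m'' with any⇒∃ (λ s → adjacent G s w) S (proj₂ (∈-filterᵇ⁻ (newVertex S) (vertices n) m''))
          ... | s , s∈ , a = h s∈ ▹ adjacent⇒Adj a

  closed-reach : OnVertices G n → ∀ {S u} → Closed G n S → u ∈ S → ∀ {w} → Walk G u w → w ∈ S
  closed-reach onV cl u∈ [] = u∈
  closed-reach onV {S} cl u∈ (_▹_ {z = z} p a) =
    cl (∈-++⁺ʳ S (∈-filterᵇ⁺ (newVertex S) (vertices n) (endpoint a)
         (∃⇒any (λ s → adjacent G s z) S (closed-reach onV cl u∈ p) (Adj⇒adjacent a))))
    where
      endpoint : ∀ {y z} → Adj G y z → z ∈ vertices n
      endpoint (inj₁ m) = proj₂ (onV m)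
      endpoint (inj₂ m) = proj₁ (onV m)

  size : List ℕ → ℕ
  size S = length (filterᵇ (_∈ᵇ S) (vertices n))

  grow-step : ∀ S → Closed G n S ⊎ size S < size (grow G n S)
  grow-step S with All.all? (λ w → T? (w ∈ᵇ S)) (filterᵇ (newVertex S) (vertices n))
  ... | yes old = inj₁ closed
    where
      closed : Closed G n S
      closed m with ∈-++⁻ S m
      ... | inj₁ m' = m'
      ... | inj₂ m' = ∈ᵇ⇒∈ (All.lookup old m')
  ... | no ¬old with find (¬All⇒Any¬ (λ w → T? (w ∈ᵇ S)) _ ¬old)
  ... | w , w∈ , w∉ =
    inj₂ (length-filterᵇ-< (_∈ᵇ S) (_∈ᵇ grow G n S) (vertices n)
           (λ x _ t → ∈⇒∈ᵇ (grow-⊇ S (∈ᵇ⇒∈ t)))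
           (proj₁ (∈-filterᵇ⁻ (newVertex S) (vertices n) w∈)) (∈⇒∈ᵇ (∈-++⁺ʳ S w∈)) w∉)

  -- after k steps the set is closed or has more than k vertices; as [n]
  -- has only n vertices, n steps produce a closed set
  component-closed : ∀ {u} → u ∈ vertices n → Closed G n (component G n u)
  component-closed {u} u∈ with grows n
    where
      grows : ∀ k → Closed G n (iter k (grow G n) (u ∷ [])) ⊎ k < size (iter k (grow G n) (u ∷ []))
      grows zero = inj₂ (filter-some (T? ∘ (_∈ᵇ (u ∷ []))) (lose u∈ (∈⇒∈ᵇ {u} {u ∷ []} (here refl))))
      grows (suc k) rewrite iterate-suc k (u ∷ []) with grows k
      ... | inj₁ cl = inj₁ (grow-mono cl)
      ... | inj₂ big with grow-step (iter k (grow G n) (u ∷ []))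
      ...   | inj₁ cl = inj₁ (grow-mono cl)
      ...   | inj₂ bigger = inj₂ (<-≤-trans (s≤s big) bigger)
  ... | inj₁ cl  = cl
  ... | inj₂ big = ⊥-elim (<⇒≱ big (≤-trans (length-filter (T? ∘ (_∈ᵇ component G n u)) (vertices n))
                                            (≤-reflexive (length-vertices n))))

  component-complete : OnVertices G n → ∀ {u} → u ∈ vertices n → ∀ {w} →
                       Walk G u w → w ∈ component G n u
  component-complete onV {u} u∈ =
    closed-reach onV (component-closed u∈) (iterate-⊇ n (u ∷ []) (here refl))

-- f_G(i) in terms of walks

Least : Graph → ℕ → Set
Least G u = ∀ w → Walk G u w → u ≤ w

Encloses : Graph → ℕ → Edge → Set
Encloses G u e = ∀ w → Walk G u w → proj₁ e < w × w < proj₂ e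

ShortestEnclosingAt : Graph → ℕ → ℕ → Set
ShortestEnclosingAt G u i =
  ∃[ e ] (e ∈ G × Encloses G u e × proj₁ e ≡ i ×
          (∀ e' → e' ∈ G → Encloses G u e' → edgeLength e ≤ edgeLength e'))

Counted : Graph → ℕ → ℕ → Set
Counted G u i = Least G u × ShortestEnclosingAt G u i

counted? : Graph → ℕ → ℕ → ℕ → Bool
counted? G n i u = isRep G n u ∧ shortestAbove G (component G n u) i

module CountedSpec (G : Graph) (n : ℕ) (onV : OnVertices G n) {u : ℕ} (u∈ : u ∈ vertices n) where
  open Components G n

  private
    C : List ℕ
    C = component G n u

    inC : ∀ {w} → Walk G u w → w ∈ C
    inC = component-complete onV u∈

    above : List Edge
    above = filterᵇ (between C) G

    shortest : Edge → Bool
    shortest e = all (λ e' → edgeLength e ≤ᵇ edgeLength e') above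

  least⁻ : T (isRep G n u) → Least G u
  least⁻ h w p = ≤ᵇ⇒≤ u w (all⇒∀ (u ≤ᵇ_) C h (inC p))

  least⁺ : Least G u → T (isRep G n u)
  least⁺ h = ∀⇒all (u ≤ᵇ_) C λ w m → ≤⇒≤ᵇ (h w (component-sound u m))

  encloses⁻ : ∀ e → T (between C e) → Encloses G u e
  encloses⁻ (a , b) h w p =
    let a<w , w<b = T-∧-elim (all⇒∀ (λ w → (a <ᵇ w) ∧ (w <ᵇ b)) C h (inC p))
    in <ᵇ⇒< a w a<w , <ᵇ⇒< w b w<b

  encloses⁺ : ∀ e → Encloses G u e → T (between C e)
  encloses⁺ (a , b) h = ∀⇒all (λ w → (a <ᵇ w) ∧ (w <ᵇ b)) C λ w m →
    let a<w , w<b = h w (component-sound u m) in T-∧-intro (<⇒<ᵇ a<w) (<⇒<ᵇ w<b)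

  shortest⁻ : ∀ {i} → T (shortestAbove G C i) → ShortestEnclosingAt G u i
  shortest⁻ {i} h with any⇒∃ (λ e → (proj₁ e ≡ᵇ i) ∧ shortest e) above h
  ... | e , e∈ , t with ∈-filterᵇ⁻ (between C) G e∈ | T-∧-elim {proj₁ e ≡ᵇ i} t
  ... | e∈G , enc | starts , min =
    e , e∈G , encloses⁻ e enc , ≡ᵇ⇒≡ _ i starts , λ e' e'∈ enc' →
      ≤ᵇ⇒≤ _ _ (all⇒∀ (λ e' → edgeLength e ≤ᵇ edgeLength e') above min
                  (∈-filterᵇ⁺ (between C) G e'∈ (encloses⁺ e' enc')))

  shortest⁺ : ∀ {i} → ShortestEnclosingAt G u i → T (shortestAbove G C i)
  shortest⁺ {i} (e , e∈ , enc , starts , min) =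
    ∃⇒any (λ e → (proj₁ e ≡ᵇ i) ∧ shortest e) above (∈-filterᵇ⁺ (between C) G e∈ (encloses⁺ e enc))
      (T-∧-intro (≡⇒≡ᵇ _ i starts) (∀⇒all (λ e' → edgeLength e ≤ᵇ edgeLength e') above λ e' m →
         let e'∈ , enc' = ∈-filterᵇ⁻ (between C) G m in ≤⇒≤ᵇ (min e' e'∈ (encloses⁻ e' enc'))))

  counted⁻ : ∀ {i} → T (counted? G n i u) → Counted G u i
  counted⁻ h = let rep , sh = T-∧-elim {isRep G n u} h in least⁻ rep , shortest⁻ sh

  counted⁺ : ∀ {i} → Counted G u i → T (counted? G n i u)
  counted⁺ (rep , sh) = T-∧-intro (least⁺ rep) (shortest⁺ sh)

counted?-cong : ∀ {G G' n u} i → OnVertices G n → OnVertices G' n → u ∈ vertices n →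
                (Counted G u i → Counted G' u i) → (Counted G' u i → Counted G u i) →
                counted? G n i u ≡ counted? G' n i u
counted?-cong {G} {G'} {n} i onV onV' u∈ to from =
  T-ext (CountedSpec.counted⁺ G' n onV' u∈ ∘ to ∘ CountedSpec.counted⁻ G n onV u∈)
        (CountedSpec.counted⁺ G n onV u∈ ∘ from ∘ CountedSpec.counted⁻ G' n onV' u∈)

f-cong : ∀ {G G' n} i → OnVertices G n → OnVertices G' n →
         (∀ {u} → u ∈ vertices n → Counted G u i → Counted G' u i) →
         (∀ {u} → u ∈ vertices n → Counted G' u i → Counted G u i) → f G n i ≡ f G' n i
f-cong {G} {G'} {n} i onV onV' to from =
  cong length (filterᵇ-cong (counted? G n i) (counted? G' n i) (vertices n) λ u u∈ →
    counted?-cong i onV onV' u∈ (to u∈) (from u∈))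

walk? : ∀ G n {x} y → OnVertices G n → x ∈ vertices n → Walk G x y ⊎ ¬ Walk G x y
walk? G n {x} y onV x∈ with y ∈ᵇ component G n x in eq
... | true  = inj₁ (Components.component-sound G n x (∈ᵇ⇒∈ (subst T (sym eq) _)))
... | false = inj₂ λ p → subst T eq (∈⇒∈ᵇ (Components.component-complete G n onV x∈ p))

Noncrossing : Graph → Set
Noncrossing G = ∀ {x y p q} → (x , y) ∈ G → (p , q) ∈ G → x < p → p < y → y < q → ⊥

nested-shorter : ∀ {x y p q} → x < p → p < y → q ≤ y → q ∸ p < y ∸ x
nested-shorter {p = p} x<p p<y q≤y = ≤-<-trans (∸-monoˡ-≤ p q≤y) (∸-monoʳ-< x<p (<⇒≤ p<y))

-- two edges of a noncrossing graph above a common vertex u with the same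
-- length start at the same vertex: otherwise one is nested in the other
same-length-same-start : ∀ {G} → Noncrossing G → ∀ {x y p q u} → (x , y) ∈ G → (p , q) ∈ G →
  x < u → u < y → p < u → u < q → y ∸ x ≡ q ∸ p → x ≡ p
same-length-same-start nc {x} {y} {p} {q} e₁ e₂ x<u u<y p<u u<q eq with <-cmp x p
... | tri≈ _ x≡p _ = x≡p
... | tri< x<p _ _ with <-cmp q y
...   | tri> _ _ y<q  = ⊥-elim (nc e₁ e₂ x<p (<-trans p<u u<y) y<q)
...   | tri< q<y _ _  = ⊥-elim (<-irrefl (sym eq) (nested-shorter x<p (<-trans p<u u<y) (<⇒≤ q<y)))
...   | tri≈ _ refl _ = ⊥-elim (<-irrefl (sym eq) (nested-shorter x<p (<-trans p<u u<y) ≤-refl))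
same-length-same-start nc {x} {y} {p} {q} e₁ e₂ x<u u<y p<u u<q eq | tri> _ _ p<x with <-cmp y q
...   | tri> _ _ q<y  = ⊥-elim (nc e₂ e₁ p<x (<-trans x<u u<q) q<y)
...   | tri< y<q _ _  = ⊥-elim (<-irrefl eq (nested-shorter p<x (<-trans x<u u<q) (<⇒≤ y<q)))
...   | tri≈ _ refl _ = ⊥-elim (<-irrefl eq (nested-shorter p<x (<-trans x<u u<q) ≤-refl))

enclosing-unique : ∀ {G} → Noncrossing G → ∀ {u} e e' → e ∈ G → e' ∈ G →
  Encloses G u e → Encloses G u e' → edgeLength e ≡ edgeLength e' → e ≡ e'
enclosing-unique nc {u} (x , y) (p , q) m m' enc enc' eq
  with enc u [] | enc' u [] | same-length-same-start nc m m' (proj₁ (enc u [])) (proj₂ (enc u []))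
                                (proj₁ (enc' u [])) (proj₂ (enc' u [])) eq
... | x<u , u<y | _ , u<q | refl =
  cong (x ,_) (∸-cancelʳ-≡ {o = x} (<⇒≤ (<-trans x<u u<y)) (<⇒≤ (<-trans x<u u<q)) eq)

-- The shape of the graphs in R^𝒪 between P_n and a leaf

record Shape (n : ℕ) (H : Graph) (c : ℕ) : Set where
  field
    bounded     : ∀ {x y} → (x , y) ∈ H → 1 ≤ x × x < y × y ≤ n
    bridge      : ∀ {x y} → (x , y) ∈ H → ¬ Walk (remove1 (x , y) H) x y
    noncrossing : Noncrossing H
    settled     : ∀ w → w < c → ¬ Reducible H w
    pathTail    : ∀ w → c ≤ w → w < n → (w , suc w) ∈ H
    unitFrom    : ∀ {x y} → (x , y) ∈ H → c ≤ x → y ≡ suc x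
    unitBeyond  : ∀ {x y} → (x , y) ∈ H → suc c < y → suc x ≡ y

module ShapeFacts {n H c} (S : Shape n H c) where
  open Shape S

  -- bridges are simple edges: no second copy survives the removal of one
  no-copy : ∀ {e} → ¬ e ∈ remove1 e H
  no-copy {x , y} m = bridge (remove1-⊆ (x , y) H m) (edgeWalk m)

  onVertices : OnVertices H n
  onVertices m = let 1≤x , x<y , y≤n = bounded m in
    ∈-vertices⁺ 1≤x (≤-trans (<⇒≤ x<y) y≤n) , ∈-vertices⁺ (≤-trans 1≤x (<⇒≤ x<y)) y≤n

  cursor≤ : ∀ {a v b} → OReduction H a v b → c ≤ v
  cursor≤ {a} {v} {b} (a∈ , a<v , b∈ , v<b , _) with <-cmp v c
  ... | tri< v<c _ _ = ⊥-elim (settled v v<c ((a , a∈ , a<v) , (b , b∈ , v<b)))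
  ... | tri≈ _ v≡c _ = ≤-reflexive (sym v≡c)
  ... | tri> _ _ c<v = <⇒≤ c<v

  reduction-unit : ∀ {a v b} → OReduction H a v b → b ≡ suc v
  reduction-unit R@(_ , _ , b∈ , _) = unitFrom b∈ (cursor≤ R)

  unenclosed : ∀ {u i} → Walk H u n → ¬ ShortestEnclosingAt H u i
  unenclosed p (_ , m , enc , _) = <⇒≱ (proj₂ (enc n p)) (proj₂ (proj₂ (bounded m)))

<⇒≤∸1 : ∀ {n x} → x < n → x ≤ n ∸ 1
<⇒≤∸1 {suc n} x<n = ≤-pred x<n

≤∸1⇒< : ∀ {n x} → 1 ≤ x → x ≤ n ∸ 1 → x < n
≤∸1⇒< {zero}  1≤x x≤0 = ⊥-elim (<⇒≱ 1≤x x≤0)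
≤∸1⇒< {suc n} _   x≤n = s≤s x≤n

module PathGraph (n : ℕ) where
  P : Graph
  P = pathGraph n

  ∈-path⁻ : ∀ {x y} → (x , y) ∈ P → y ≡ suc x × 1 ≤ x × x ≤ n ∸ 1
  ∈-path⁻ m with ∈-map⁻ (λ i → (i , suc i)) m
  ... | i , i∈ , refl = refl , ∈-vertices⁻ i∈

  ∈-path⁺ : ∀ {w} → 1 ≤ w → w < n → (w , suc w) ∈ P
  ∈-path⁺ {w} 1≤w w<n = ∈-map⁺ (λ i → (i , suc i)) (∈-vertices⁺ 1≤w (<⇒≤∸1 w<n))

  unique-path : Unique P
  unique-path = Unique.map⁺ (cong proj₁) (unique-vertices (n ∸ 1))

  stays-left : ∀ {x w} → Walk (remove1 (x , suc x) P) x w → w ≤ x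
  stays-left [] = ≤-refl
  stays-left {x} (p ▹ inj₁ m) with stays-left p | ∈-path⁻ (remove1-⊆ (x , suc x) P m)
  ... | y≤x | refl , _ with m≤n⇒m<n∨m≡n y≤x
  ...   | inj₁ y<x  = y<x
  ...   | inj₂ refl = ⊥-elim (no-second-copy P unique-path m)
    where
      no-second-copy : ∀ {e} L → Unique L → ¬ e ∈ remove1 e L
      no-second-copy {e} (x ∷ L) (x∉ ∷ u) m with e ≡ᴱ x in eq
      ... | true = All.lookup x∉ m (sym (≡ᴱ⇒≡ (subst T (sym eq) _)))
      no-second-copy {e} (x ∷ L) (x∉ ∷ u) (here refl) | false = subst T eq (≡⇒≡ᴱ {e} refl)
      no-second-copy {e} (x ∷ L) (x∉ ∷ u) (there m)   | false = no-second-copy L u m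
  stays-left {x} (p ▹ inj₂ m) with stays-left p | ∈-path⁻ (remove1-⊆ (x , suc x) P m)
  ... | y≤x | refl , _ = <⇒≤ y≤x

  shape : Shape n P 1
  shape = record
    { bounded     = bounded
    ; bridge      = bridge
    ; noncrossing = noncrossing
    ; settled     = λ { zero _ ((_ , _ , ()) , _) ; (suc w) (s≤s ()) }
    ; pathTail    = λ w 1≤w w<n → ∈-path⁺ 1≤w w<n
    ; unitFrom    = λ m _ → proj₁ (∈-path⁻ m)
    ; unitBeyond  = λ m _ → sym (proj₁ (∈-path⁻ m))
    }
    where
      bounded : ∀ {x y} → (x , y) ∈ P → 1 ≤ x × x < y × y ≤ n
      bounded m with ∈-path⁻ m
      ... | refl , 1≤x , x≤n-1 = 1≤x , ≤-refl , ≤∸1⇒< 1≤x x≤n-1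
      bridge : ∀ {x y} → (x , y) ∈ P → ¬ Walk (remove1 (x , y) P) x y
      bridge m p with ∈-path⁻ m
      ... | refl , _ = <-irrefl refl (stays-left p)
      noncrossing : Noncrossing P
      noncrossing m _ x<p p<y _ with ∈-path⁻ m
      ... | refl , _ = <-irrefl refl (<-≤-trans x<p (≤-pred p<y))

  -- no edge of P encloses a vertex, so f_P = 0
  f-path : ∀ i → f P n i ≡ 0
  f-path i = trans (cong length (filterᵇ-cong (counted? P n i) (λ _ → false) (vertices n) λ u u∈ →
                      ¬T⇒false λ t → unenclosed-unit (proj₂ (CountedSpec.counted⁻ P n (ShapeFacts.onVertices shape) u∈ t))))
                   (nothing-counted (vertices n))
    where
      unenclosed-unit : ∀ {u} → ¬ ShortestEnclosingAt P u i
      unenclosed-unit {u} (_ , m , enc , _) with ∈-path⁻ m | enc u []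
      ... | refl , _ | x<u , u<x+1 = <-irrefl refl (<-≤-trans x<u (≤-pred u<x+1))
      nothing-counted : ∀ (L : List ℕ) → length (filterᵇ (λ _ → false) L) ≡ 0
      nothing-counted []      = refl
      nothing-counted (_ ∷ L) = nothing-counted L

module Reduction {n H c a v} (S : Shape n H c) (R : OReduction H a v (suc v)) where
  open Shape S
  open ShapeFacts S

  A B N : Edge
  A = (a , v)
  B = (v , suc v)
  N = (a , suc v)

  A∈ : A ∈ H
  A∈ = proj₁ R
  a<v : a < v
  a<v = proj₁ (proj₂ R)
  B∈ : B ∈ H
  B∈ = proj₁ (proj₂ (proj₂ R))
  v-first : ∀ w → w < v → ¬ Reducible H w
  v-first = proj₁ (proj₂ (proj₂ (proj₂ (proj₂ R))))
  a-least : ∀ a' → (a' , v) ∈ H → a' < v → a ≤ a'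
  a-least = proj₁ (proj₂ (proj₂ (proj₂ (proj₂ (proj₂ R)))))

  c≤v : c ≤ v
  c≤v = cursor≤ R
  out-of-v : ∀ {y} → (v , y) ∈ H → y ≡ suc v
  out-of-v m = unitFrom m c≤v
  v+1≤n : suc v ≤ n
  v+1≤n = proj₂ (proj₂ (bounded B∈))
  1≤a : 1 ≤ a
  1≤a = proj₁ (bounded A∈)

  A≢B : A ≢ B
  A≢B ()

  H₁ H₂ H₃ : Graph
  H₁ = red₁ H a v (suc v)
  H₂ = red₂ H a v (suc v)
  H₃ = red₃ H a v (suc v)

  ∉-removed : ∀ {e e'} → e' ∈ remove1 e H → e' ≢ e
  ∉-removed m refl = no-copy m

  H₃⊆H∖A : ∀ {e} → e ∈ remove1 A (remove1 B H) → e ∈ remove1 A H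
  H₃⊆H∖A = remove1-⊆-inner A B H

  H₃⊆H∖B : ∀ {e} → e ∈ remove1 A (remove1 B H) → e ∈ remove1 B H
  H₃⊆H∖B = remove1-⊆ A (remove1 B H)

  H₃⊆H : ∀ {e} → e ∈ remove1 A (remove1 B H) → e ∈ H
  H₃⊆H = remove1-⊆ B H ∘ H₃⊆H∖B

  ∈H₁⁻ : ∀ {e} → e ∈ H₁ → e ≡ N ⊎ (e ∈ H × e ≢ B)
  ∈H₁⁻ (here refl) = inj₁ refl
  ∈H₁⁻ (there m)   = inj₂ (remove1-⊆ B H m , ∉-removed m)

  ∈H₁⁺ : ∀ {e} → e ∈ H → e ≢ B → e ∈ H₁
  ∈H₁⁺ m e≢B = there (remove1-⊇≢ H m e≢B)

  ∈H₂⁻ : ∀ {e} → e ∈ H₂ → e ≡ N ⊎ (e ∈ H × e ≢ A)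
  ∈H₂⁻ (here refl) = inj₁ refl
  ∈H₂⁻ (there m)   = inj₂ (remove1-⊆ A H m , ∉-removed m)

  ∈H₂⁺ : ∀ {e} → e ∈ H → e ≢ A → e ∈ H₂
  ∈H₂⁺ m e≢A = there (remove1-⊇≢ H m e≢A)

  ∈H₃⁻ : ∀ {e} → e ∈ H₃ → e ≡ N ⊎ (e ∈ H × e ≢ A × e ≢ B)
  ∈H₃⁻ (here refl) = inj₁ refl
  ∈H₃⁻ (there m)   = inj₂ (H₃⊆H m , ∉-removed (H₃⊆H∖A m) , ∉-removed (H₃⊆H∖B m))

  ∈H₃⁺ : ∀ {e} → e ∈ H → e ≢ A → e ≢ B → e ∈ H₃
  ∈H₃⁺ m e≢A e≢B = there (remove1-⊇≢ (remove1 B H) (remove1-⊇≢ H m e≢B) e≢A)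

  module Preserved (H' : Graph) (c' : ℕ) (v≤c' : v ≤ c') (c'≤v+1 : c' ≤ suc v)
    (edges : ∀ {e} → e ∈ H' → e ≡ N ⊎ e ∈ H)
    (bridge' : ∀ {x y} → (x , y) ∈ H' → ¬ Walk (remove1 (x , y) H') x y)
    (v-settled : v < c' → ¬ Reducible H' v)
    (pathTail' : ∀ w → c' ≤ w → w < n → (w , suc w) ∈ H') where

    bounded' : ∀ {x y} → (x , y) ∈ H' → 1 ≤ x × x < y × y ≤ n
    bounded' m with edges m
    ... | inj₁ refl = 1≤a , <-trans a<v (n<1+n v) , v+1≤n
    ... | inj₂ m'   = bounded m'

    -- N cannot cross an edge of H: that edge would cross A or leave v
    noncrossing' : Noncrossing H'
    noncrossing' m₁ m₂ x<p p<y y<q with edges m₁ | edges m₂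
    ... | inj₁ refl | inj₁ refl = <-irrefl refl x<p
    ... | inj₂ m₁'  | inj₂ m₂'  = noncrossing m₁' m₂' x<p p<y y<q
    ... | inj₁ refl | inj₂ m₂' with <-cmp _ v
    ...   | tri< p<v _ _ = noncrossing A∈ m₂' x<p p<v (<-trans (n<1+n v) y<q)
    ...   | tri≈ _ refl _ = <-irrefl (sym (out-of-v m₂')) y<q
    ...   | tri> _ _ v<p = <-irrefl refl (<-≤-trans p<y v<p)
    noncrossing' {x} {y} m₁ m₂ x<p p<y y<q | inj₂ m₁' | inj₁ refl with <-cmp y v
    ...   | tri< y<v _ _ = noncrossing m₁' A∈ x<p p<y y<v
    ...   | tri≈ _ refl _ = <⇒≱ x<p (a-least x m₁' (<-trans x<p p<y))
    ...   | tri> _ _ v<y = <-irrefl refl (<-≤-trans y<q v<y)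

    -- below v nothing becomes reducible: N starts at a, which is not reducible in H
    settled-below-v : ∀ w → w < v → ¬ Reducible H' w
    settled-below-v w w<v ((x , x∈ , x<w) , (y , y∈ , w<y)) with edges x∈
    ... | inj₁ refl = <-irrefl refl (<-trans w<v (n<1+n v))
    ... | inj₂ x∈' with edges y∈
    ...   | inj₁ refl = v-first a a<v ((x , x∈' , x<w) , (v , A∈ , a<v))
    ...   | inj₂ y∈'  = v-first w w<v ((x , x∈' , x<w) , (y , y∈' , w<y))

    settled' : ∀ w → w < c' → ¬ Reducible H' w
    settled' w w<c' with <-cmp w v
    ... | tri< w<v _ _ = settled-below-v w w<v
    ... | tri≈ _ refl _ = v-settled w<c'
    ... | tri> _ _ v<w = ⊥-elim (<-irrefl refl (<-≤-trans v<w (≤-pred (≤-trans w<c' c'≤v+1))))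

    unitFrom' : ∀ {x y} → (x , y) ∈ H' → c' ≤ x → y ≡ suc x
    unitFrom' m c'≤x with edges m
    ... | inj₁ refl = ⊥-elim (<⇒≱ a<v (≤-trans v≤c' c'≤x))
    ... | inj₂ m'   = unitFrom m' (≤-trans c≤v (≤-trans v≤c' c'≤x))

    unitBeyond' : ∀ {x y} → (x , y) ∈ H' → suc c' < y → suc x ≡ y
    unitBeyond' m c'+1<y with edges m
    ... | inj₁ refl = ⊥-elim (<⇒≱ c'+1<y (s≤s v≤c'))
    ... | inj₂ m'   = unitBeyond m' (≤-<-trans (s≤s (≤-trans c≤v v≤c')) c'+1<y)

    shape' : Shape n H' c'
    shape' = record
      { bounded = bounded' ; bridge = bridge' ; noncrossing = noncrossing'
      ; settled = settled' ; pathTail = pathTail' ; unitFrom = unitFrom' ; unitBeyond = unitBeyond' }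

  dropN : ∀ G {x y} → Walk (remove1 N (N ∷ G)) x y → Walk G x y
  dropN G = subst (λ G' → Walk G' _ _) (remove1-head N G)

  dropOther : ∀ {e} G → e ≢ N → ∀ {x y} → Walk (remove1 e (N ∷ G)) x y → Walk (N ∷ remove1 e G) x y
  dropOther {e} G e≢N = subst (λ G' → Walk G' _ _) (remove1-cons e N G e≢N)

  -- without e ∉ {A, B}, the edge N can be replaced by the walk a → v → v+1
  reroute : ∀ {e G} → A ≢ e → B ≢ e → (∀ {f} → f ∈ G → f ∈ remove1 e H) →
            ∀ {x y} → Walk (N ∷ G) x y → Walk (remove1 e H) x y
  reroute A≢e B≢e sub = simulate λ
    { (here refl) → edgeWalk (remove1-⊇≢ H A∈ A≢e) ▹ inj₁ (remove1-⊇≢ H B∈ B≢e)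
    ; (there m)   → edgeWalk (sub m) }

  v↛a : ¬ Walk H₃ v a
  v↛a W with walk-split N W
  ... | inj₁ w        = bridge A∈ (reverse (walk-mono H₃⊆H∖A w))
  ... | inj₂ (inj₁ w) = bridge A∈ (reverse (walk-mono H₃⊆H∖A w))
  ... | inj₂ (inj₂ w) = bridge B∈ (walk-mono H₃⊆H∖B w)

  v↛v+1 : ¬ Walk H₃ v (suc v)
  v↛v+1 W with walk-split N W
  ... | inj₁ w        = bridge B∈ (walk-mono H₃⊆H∖B w)
  ... | inj₂ (inj₁ w) = bridge A∈ (reverse (walk-mono H₃⊆H∖A w))
  ... | inj₂ (inj₂ w) = bridge B∈ (walk-mono H₃⊆H∖B w)

  bridge₁ : ∀ {x y} → (x , y) ∈ H₁ → ¬ Walk (remove1 (x , y) H₁) x y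
  bridge₁ {x} {y} m W with (x , y) ≟ᴱ N
  ... | inj₁ refl = bridge B∈ (reverse (edgeWalk (remove1-⊇≢ H A∈ A≢B)) ++ʷ dropN (remove1 B H) W)
  ... | inj₂ e≢N with ∈H₁⁻ m
  ...   | inj₁ e≡N = e≢N e≡N
  ...   | inj₂ (e∈ , e≢B) with (x , y) ≟ᴱ A
  ...     | inj₁ refl = v↛a (reverse (dropOther (remove1 B H) e≢N W))
  ...     | inj₂ e≢A  = bridge e∈ (reroute (e≢A ∘ sym) (e≢B ∘ sym) (remove1-⊆-inner (x , y) B H)
                                           (dropOther (remove1 B H) e≢N W))

  bridge₂ : ∀ {x y} → (x , y) ∈ H₂ → ¬ Walk (remove1 (x , y) H₂) x y
  bridge₂ {x} {y} m W with (x , y) ≟ᴱ N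
  ... | inj₁ refl = bridge A∈ (dropN (remove1 A H) W ▹ inj₂ (remove1-⊇≢ H B∈ (A≢B ∘ sym)))
  ... | inj₂ e≢N with ∈H₂⁻ m
  ...   | inj₁ e≡N = e≢N e≡N
  ...   | inj₂ (e∈ , e≢A) with (x , y) ≟ᴱ B
  ...     | inj₁ refl = v↛v+1 (subst (λ G → Walk (N ∷ G) v (suc v)) (remove1-comm B A H)
                                       (dropOther (remove1 A H) e≢N W))
  ...     | inj₂ e≢B  = bridge e∈ (reroute (e≢A ∘ sym) (e≢B ∘ sym) (remove1-⊆-inner (x , y) A H)
                                           (dropOther (remove1 A H) e≢N W))

  bridge₃ : ∀ {x y} → (x , y) ∈ H₃ → ¬ Walk (remove1 (x , y) H₃) x y
  bridge₃ {x} {y} m W with (x , y) ≟ᴱ N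
  ... | inj₁ refl = bridge B∈ (reverse (edgeWalk (remove1-⊇≢ H A∈ A≢B))
                                ++ʷ walk-mono H₃⊆H∖B (dropN (remove1 A (remove1 B H)) W))
  ... | inj₂ e≢N with ∈H₃⁻ m
  ...   | inj₁ e≡N = e≢N e≡N
  ...   | inj₂ (e∈ , e≢A , e≢B) =
    bridge e∈ (reroute (e≢A ∘ sym) (e≢B ∘ sym)
                 (remove1-⊆-inner (x , y) B H ∘ remove1-⊆-inner (x , y) A (remove1 B H))
                 (dropOther (remove1 A (remove1 B H)) e≢N W))

  forget : ∀ {e} {P : Set} → e ≡ N ⊎ (e ∈ H × P) → e ≡ N ⊎ e ∈ H
  forget (inj₁ e≡N)     = inj₁ e≡N
  forget (inj₂ (e∈ , _)) = inj₂ e∈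

  no-out-of-v : ∀ {G} → (∀ {e} → e ∈ G → e ≡ N ⊎ (e ∈ H × e ≢ B)) → v < suc v → ¬ Reducible G v
  no-out-of-v edges _ (_ , (y , y∈ , _)) with edges y∈
  ... | inj₁ refl        = <-irrefl refl a<v
  ... | inj₂ (y∈H , v≢B) = v≢B (cong (v ,_) (out-of-v y∈H))

  shape₁ : Shape n H₁ (suc v)
  shape₁ = Preserved.shape' H₁ (suc v) (n≤1+n v) ≤-refl (λ m → forget (∈H₁⁻ m)) bridge₁ (no-out-of-v ∈H₁⁻)
    λ w v<w w<n → ∈H₁⁺ (pathTail w (≤-trans c≤v (<⇒≤ v<w)) w<n) λ { refl → <-irrefl refl v<w }

  shape₂ : Shape n H₂ v
  shape₂ = Preserved.shape' H₂ v ≤-refl (n≤1+n v) (λ m → forget (∈H₂⁻ m)) bridge₂ (λ v<v → ⊥-elim (<-irrefl refl v<v))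
    λ w v≤w w<n → ∈H₂⁺ (pathTail w (≤-trans c≤v v≤w) w<n) λ { refl → <⇒≱ a<v v≤w }

  shape₃ : Shape n H₃ (suc v)
  shape₃ = Preserved.shape' H₃ (suc v) (n≤1+n v) ≤-refl (λ m → forget (∈H₃⁻ m)) bridge₃
    (no-out-of-v (λ m → map₂ (λ (e∈ , _ , e≢B) → e∈ , e≢B) (∈H₃⁻ m)))
    λ w v<w w<n → ∈H₃⁺ (pathTail w (≤-trans c≤v (<⇒≤ v<w)) w<n)
                       (λ { refl → <-irrefl refl (<-trans a<v v<w) }) λ { refl → <-irrefl refl v<w }

-- How a reduction step changes f

module Counting {n H c a v} (S : Shape n H c) (R : OReduction H a v (suc v)) where
  open Shape S
  open ShapeFacts S
  open Reduction S R

  |N|≡1+|A| : edgeLength N ≡ suc (edgeLength A)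
  |N|≡1+|A| = +-∸-assoc 1 (<⇒≤ a<v)

  B-encloses-nothing : ∀ {G u} → ¬ Encloses G u B
  B-encloses-nothing enc = let v<u , u<v+1 = enc _ [] in <-irrefl refl (<-≤-trans v<u (≤-pred u<v+1))

  A⇒N-encloses : ∀ {G u} → Encloses G u A → Encloses G u N
  A⇒N-encloses enc w p = let a<w , w<v = enc w p in a<w , <-trans w<v (n<1+n v)

  N⇒A-encloses : ∀ {G u} → (Walk G u v → Walk G u a) → Encloses G u N → Encloses G u A
  N⇒A-encloses {G} {u} v⇒a enc w p with enc w p
  ... | a<w , w<v+1 with <-cmp w v
  ...   | tri< w<v _ _ = a<w , w<v
  ...   | tri≈ _ refl _ = ⊥-elim (<-irrefl refl (proj₁ (enc a (v⇒a p))))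
  ...   | tri> _ _ v<w = ⊥-elim (<-irrefl refl (<-≤-trans v<w (≤-pred w<v+1)))

  module SameComponent {G G' u} (to : ∀ {w} → Walk G u w → Walk G' u w)
                                (from : ∀ {w} → Walk G' u w → Walk G u w) where
    least⇒ : Least G u → Least G' u
    least⇒ l w p = l w (from p)
    least⇐ : Least G' u → Least G u
    least⇐ l w p = l w (to p)
    encloses⇒ : ∀ {e} → Encloses G u e → Encloses G' u e
    encloses⇒ enc w p = enc w (from p)
    encloses⇐ : ∀ {e} → Encloses G' u e → Encloses G u e
    encloses⇐ enc w p = enc w (to p)

  -- G' arises from G by exchanging A for the one longer edge N (and possibly
  -- dropping B, which encloses nothing).  If reaching v forces reaching a,
  -- the shortest enclosing edge is the same or is exchanged A ↔ N, so it
  -- starts at the same vertex.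
  module Exchange (G G' : Graph) (u : ℕ) (ncG : Noncrossing G) (ncG' : Noncrossing G')
    (to : ∀ {w} → Walk G u w → Walk G' u w) (from : ∀ {w} → Walk G' u w → Walk G u w)
    (edges' : ∀ {e} → e ∈ G' → e ≡ N ⊎ (e ∈ G × e ≢ A × e ≢ N))
    (edges : ∀ {e} → e ∈ G → e ≡ A ⊎ (e ≡ B ⊎ e ∈ G'))
    (A∈G : A ∈ G) (N∈G' : N ∈ G') (v⇒a : Walk G u v → Walk G u a) where
    open SameComponent to from

    shortest⇐ : ∀ {i} → ShortestEnclosingAt G' u i → ShortestEnclosingAt G u i
    shortest⇐ (e , e∈ , enc , starts , min) with edges' e∈
    ... | inj₁ refl = A , A∈G , N⇒A-encloses v⇒a (encloses⇐ enc) , starts , minA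
      where
        minA : ∀ e' → e' ∈ G → Encloses G u e' → edgeLength A ≤ edgeLength e'
        minA e' e'∈ enc' with edges e'∈
        ... | inj₁ refl         = ≤-refl
        ... | inj₂ (inj₁ refl)  = ⊥-elim (B-encloses-nothing enc')
        ... | inj₂ (inj₂ e'∈G') = ≤-trans (n≤1+n _) (subst (_≤ edgeLength e') |N|≡1+|A| (min e' e'∈G' (encloses⇒ enc')))
    ... | inj₂ (e∈G , _ , e≢N) = e , e∈G , encloses⇐ enc , starts , minE
      where
        minE : ∀ e' → e' ∈ G → Encloses G u e' → edgeLength e ≤ edgeLength e'
        minE e' e'∈ enc' with edges e'∈
        ... | inj₁ refl = ≤-pred (≤∧≢⇒< (subst (edgeLength e ≤_) |N|≡1+|A| (min N N∈G' encN))
                            λ eq → e≢N (enclosing-unique ncG' e N e∈ N∈G' enc encN (trans eq (sym |N|≡1+|A|))))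
          where encN = encloses⇒ (A⇒N-encloses enc')
        ... | inj₂ (inj₁ refl)  = ⊥-elim (B-encloses-nothing enc')
        ... | inj₂ (inj₂ e'∈G') = min e' e'∈G' (encloses⇒ enc')

    shortest⇒ : ∀ {i} → ShortestEnclosingAt G u i → ShortestEnclosingAt G' u i
    shortest⇒ (e , e∈ , enc , starts , min) with edges e∈
    ... | inj₁ refl = N , N∈G' , encloses⇒ (A⇒N-encloses enc) , starts , minN
      where
        minN : ∀ e' → e' ∈ G' → Encloses G' u e' → edgeLength N ≤ edgeLength e'
        minN e' e'∈ enc' with edges' e'∈
        ... | inj₁ refl = ≤-refl
        ... | inj₂ (e'∈G , e'≢A , _) = subst (_≤ edgeLength e') (sym |N|≡1+|A|)
               (≤∧≢⇒< (min e' e'∈G (encloses⇐ enc'))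
                  λ eq → e'≢A (sym (enclosing-unique ncG A e' A∈G e'∈G enc (encloses⇐ enc') eq)))
    ... | inj₂ (inj₁ refl) = ⊥-elim (B-encloses-nothing enc)
    ... | inj₂ (inj₂ e∈G') = e , e∈G' , encloses⇒ enc , starts , minE
      where
        minE : ∀ e' → e' ∈ G' → Encloses G' u e' → edgeLength e ≤ edgeLength e'
        minE e' e'∈ enc' with edges' e'∈
        ... | inj₁ refl = ≤-trans (min A A∈G (N⇒A-encloses v⇒a (encloses⇐ enc')))
                                  (subst (edgeLength A ≤_) (sym |N|≡1+|A|) (n≤1+n _))
        ... | inj₂ (e'∈G , _) = min e' e'∈G (encloses⇐ enc')

    counted⇒ : ∀ {i} → Counted G u i → Counted G' u i
    counted⇒ (l , s) = least⇒ l , shortest⇒ s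
    counted⇐ : ∀ {i} → Counted G' u i → Counted G u i
    counted⇐ (l , s) = least⇐ l , shortest⇐ s

  a→v+1 : Walk H a (suc v)
  a→v+1 = edgeWalk A∈ ▹ inj₁ B∈

  A∈H₁ : A ∈ H₁
  A∈H₁ = ∈H₁⁺ A∈ A≢B

  B∈H₂ : B ∈ H₂
  B∈H₂ = ∈H₂⁺ B∈ (A≢B ∘ sym)

  H₁→H : ∀ {x y} → Walk H₁ x y → Walk H x y
  H₁→H = simulate λ { (here refl) → a→v+1 ; (there m) → edgeWalk (remove1-⊆ B H m) }

  H→H₁ : ∀ {x y} → Walk H x y → Walk H₁ x y
  H→H₁ = simulate λ {y} {z} m → case-B (((y , z) ≟ᴱ B)) m
    where
      case-B : ∀ {y z} → (y , z) ≡ B ⊎ (y , z) ≢ B → (y , z) ∈ H → Walk H₁ y z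
      case-B (inj₁ refl) _ = reverse (edgeWalk A∈H₁) ▹ inj₁ (here refl)
      case-B (inj₂ e≢B)  m = edgeWalk (∈H₁⁺ m e≢B)

  H₂→H : ∀ {x y} → Walk H₂ x y → Walk H x y
  H₂→H = simulate λ { (here refl) → a→v+1 ; (there m) → edgeWalk (remove1-⊆ A H m) }

  H→H₂ : ∀ {x y} → Walk H x y → Walk H₂ x y
  H→H₂ = simulate λ {y} {z} m → case-A (((y , z) ≟ᴱ A)) m
    where
      case-A : ∀ {y z} → (y , z) ≡ A ⊎ (y , z) ≢ A → (y , z) ∈ H → Walk H₂ y z
      case-A (inj₁ refl) _ = edgeWalk (here refl) ▹ inj₂ B∈H₂
      case-A (inj₂ e≢A)  m = edgeWalk (∈H₂⁺ m e≢A)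

  H₃→H : ∀ {x y} → Walk H₃ x y → Walk H x y
  H₃→H = simulate λ { (here refl) → a→v+1 ; (there m) → edgeWalk (H₃⊆H m) }

  old-≢N : ∀ {G c'} → Shape n (N ∷ G) c' → ∀ {e} → e ∈ G → e ≢ N
  old-≢N {G} S' m refl = ShapeFacts.no-copy S' (subst (N ∈_) (sym (remove1-head N G)) m)

  ∈H₂⁻' : ∀ {e} → e ∈ H₂ → e ≡ N ⊎ (e ∈ H × e ≢ A × e ≢ N)
  ∈H₂⁻' (here refl) = inj₁ refl
  ∈H₂⁻' (there m)   = inj₂ (remove1-⊆ A H m , ∉-removed m , old-≢N shape₂ m)

  ∈H₃⁻' : ∀ {e} → e ∈ H₃ → e ≡ N ⊎ (e ∈ H × e ≢ A × e ≢ N)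
  ∈H₃⁻' (here refl) = inj₁ refl
  ∈H₃⁻' (there m)   = inj₂ (H₃⊆H m , ∉-removed (H₃⊆H∖A m) , old-≢N shape₃ m)

  ∈H⇒H₂ : ∀ {e} → e ∈ H → e ≡ A ⊎ (e ≡ B ⊎ e ∈ H₂)
  ∈H⇒H₂ {e} m with e ≟ᴱ A
  ... | inj₁ e≡A = inj₁ e≡A
  ... | inj₂ e≢A = inj₂ (inj₂ (∈H₂⁺ m e≢A))

  ∈H⇒H₃ : ∀ {e} → e ∈ H → e ≡ A ⊎ (e ≡ B ⊎ e ∈ H₃)
  ∈H⇒H₃ {e} m with e ≟ᴱ A | e ≟ᴱ B
  ... | inj₁ e≡A | _        = inj₁ e≡A
  ... | inj₂ _   | inj₁ e≡B = inj₂ (inj₁ e≡B)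
  ... | inj₂ e≢A | inj₂ e≢B = inj₂ (inj₂ (∈H₃⁺ m e≢A e≢B))

  -- left child: N is never a shortest enclosing edge, since A ∈ H₁ is shorter
  module Left (u : ℕ) where
    open SameComponent {H} {H₁} {u} H→H₁ H₁→H

    shortest⇐ : ∀ {i} → ShortestEnclosingAt H₁ u i → ShortestEnclosingAt H u i
    shortest⇐ (e , e∈ , enc , starts , min) with ∈H₁⁻ e∈
    ... | inj₁ refl = ⊥-elim (<⇒≱ (≤-reflexive (sym |N|≡1+|A|))
                               (min A A∈H₁ (N⇒A-encloses (λ p → p ▹ inj₂ A∈H₁) enc)))
    ... | inj₂ (e∈H , _) = e , e∈H , encloses⇐ enc , starts , minE
      where
        minE : ∀ e' → e' ∈ H → Encloses H u e' → edgeLength e ≤ edgeLength e'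
        minE e' e'∈ enc' with e' ≟ᴱ B
        ... | inj₁ refl = ⊥-elim (B-encloses-nothing enc')
        ... | inj₂ e'≢B = min e' (∈H₁⁺ e'∈ e'≢B) (encloses⇒ enc')

    shortest⇒ : ∀ {i} → ShortestEnclosingAt H u i → ShortestEnclosingAt H₁ u i
    shortest⇒ (e , e∈ , enc , starts , min) with e ≟ᴱ B
    ... | inj₁ refl = ⊥-elim (B-encloses-nothing enc)
    ... | inj₂ e≢B  = e , ∈H₁⁺ e∈ e≢B , encloses⇒ enc , starts , minE
      where
        minE : ∀ e' → e' ∈ H₁ → Encloses H₁ u e' → edgeLength e ≤ edgeLength e'
        minE e' e'∈ enc' with ∈H₁⁻ e'∈
        ... | inj₁ refl = ≤-trans (min A A∈ (N⇒A-encloses (λ p → p ▹ inj₂ A∈) (encloses⇐ enc')))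
                                  (subst (edgeLength A ≤_) (sym |N|≡1+|A|) (n≤1+n _))
        ... | inj₂ (e'∈H , _) = min e' e'∈H (encloses⇐ enc')

    counted⇒ : ∀ {i} → Counted H u i → Counted H₁ u i
    counted⇒ (l , s) = least⇒ l , shortest⇒ s
    counted⇐ : ∀ {i} → Counted H₁ u i → Counted H u i
    counted⇐ (l , s) = least⇐ l , shortest⇐ s

  f-left : ∀ i → f H₁ n i ≡ f H n i
  f-left i = f-cong i (ShapeFacts.onVertices shape₁) onVertices
    (λ {u} _ → Left.counted⇐ u) (λ {u} _ → Left.counted⇒ u)

  -- right child: H₂ is H with A exchanged for N
  f-right : ∀ i → f H₂ n i ≡ f H n i
  f-right i = f-cong i (ShapeFacts.onVertices shape₂) onVertices
    (λ {u} _ → Exchange.counted⇐ H H₂ u noncrossing (Shape.noncrossing shape₂)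
                 H→H₂ H₂→H ∈H₂⁻' ∈H⇒H₂ A∈ (here refl) (λ p → p ▹ inj₂ A∈))
    (λ {u} _ → Exchange.counted⇒ H H₂ u noncrossing (Shape.noncrossing shape₂)
                 H→H₂ H₂→H ∈H₂⁻' ∈H⇒H₂ A∈ (here refl) (λ p → p ▹ inj₂ A∈))

  -- middle child: only the component of v changes, and it becomes enclosed by N
  module Middle where
    shape₃-onVertices : OnVertices H₃ n
    shape₃-onVertices = ShapeFacts.onVertices shape₃

    v∈ : v ∈ vertices n
    v∈ = ∈-vertices⁺ (≤-trans 1≤a (<⇒≤ a<v)) (≤-trans (n≤1+n v) v+1≤n)

    -- the edges lost in H₃ both touch v, so a walk of H survives in H₃
    -- until it first reaches v (or v+1 through N)
    split-at-v : ∀ {u y} → Walk H u y → Walk H₃ u y ⊎ (Walk H₃ u v ⊎ Walk H₃ u (suc v))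
    split-at-v [] = inj₁ []
    split-at-v (_▹_ {y} {z} p adj) with split-at-v p
    ... | inj₂ r = inj₂ r
    ... | inj₁ q with adj
    ...   | inj₁ m with (y , z) ≟ᴱ A | (y , z) ≟ᴱ B
    ...     | inj₁ refl | _        = inj₂ (inj₂ (q ▹ inj₁ (here refl)))
    ...     | inj₂ _    | inj₁ refl = inj₂ (inj₁ q)
    ...     | inj₂ e≢A  | inj₂ e≢B = inj₁ (q ▹ inj₁ (∈H₃⁺ m e≢A e≢B))
    split-at-v (_▹_ {y} {z} p adj) | inj₁ q | inj₂ m with (z , y) ≟ᴱ A | (z , y) ≟ᴱ B
    ...     | inj₁ refl | _        = inj₂ (inj₁ q)
    ...     | inj₂ _    | inj₁ refl = inj₂ (inj₂ q)
    ...     | inj₂ e≢A  | inj₂ e≢B = inj₁ (q ▹ inj₂ (∈H₃⁺ m e≢A e≢B))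

    avoiding-v : ∀ {u} → ¬ Walk H u v → ∀ {w} → Walk H u w → Walk H₃ u w
    avoiding-v u↛v p with split-at-v p
    ... | inj₁ q        = q
    ... | inj₂ (inj₁ q) = ⊥-elim (u↛v (H₃→H q))
    ... | inj₂ (inj₂ q) = ⊥-elim (u↛v (H₃→H q ▹ inj₂ B∈))

    -- in H₃ the component of v lies in the interval (a , v]: an edge leaving
    -- it to the right would cross A or start at v, one leaving it to the left
    -- would cross A or contradict the minimality of a
    v-side : ∀ {w} → Walk H₃ v w → a < w × w ≤ v
    v-side [] = a<v , ≤-refl
    v-side (_▹_ {y} {z} p adj) with v-side p
    ... | a<y , y≤v with adj
    ...   | inj₁ m with ∈H₃⁻ m
    ...     | inj₁ refl = ⊥-elim (<-irrefl refl a<y)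
    ...     | inj₂ (m' , _ , e≢B) with <-cmp z v
    ...       | tri< z<v _ _  = <-trans a<y (proj₁ (proj₂ (bounded m'))) , <⇒≤ z<v
    ...       | tri≈ _ refl _ = <-trans a<y (proj₁ (proj₂ (bounded m'))) , ≤-refl
    ...       | tri> _ _ v<z with <-cmp y v
    ...         | tri< y<v _ _  = ⊥-elim (noncrossing A∈ m' a<y y<v v<z)
    ...         | tri≈ _ refl _ = ⊥-elim (e≢B (cong (v ,_) (out-of-v m')))
    ...         | tri> _ _ v<y  = ⊥-elim (<⇒≱ v<y y≤v)
    v-side (_▹_ {y} {z} p adj) | a<y , y≤v | inj₂ m with ∈H₃⁻ m
    ...     | inj₁ refl = ⊥-elim (<-irrefl refl (s≤s y≤v))
    ...     | inj₂ (m' , _ , _) with <-cmp a z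
    ...       | tri< a<z _ _  = a<z , ≤-trans (<⇒≤ (proj₁ (proj₂ (bounded m')))) y≤v
    ...       | tri≈ _ refl _ = ⊥-elim (v↛a (p ▹ adj))
    ...       | tri> _ _ z<a with <-cmp y v
    ...         | tri< y<v _ _  = ⊥-elim (noncrossing m' A∈ z<a a<y y<v)
    ...         | tri≈ _ refl _ = ⊥-elim (<⇒≱ z<a (a-least z m' (<-trans z<a a<v)))
    ...         | tri> _ _ v<y  = ⊥-elim (<⇒≱ v<y y≤v)

    module ComponentOfV {u} (u→v : Walk H₃ u v) where
      N-encloses : Encloses H₃ u N
      N-encloses w p = let a<w , w≤v = v-side (reverse u→v ++ʷ p) in a<w , s≤s w≤v

      -- an enclosing edge (x , y) has x < v < y; beyond v+1 edges are unit
      -- edges, so y = v+1, and by noncrossing with A also x ≤ a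
      N-shortest : ∀ e → e ∈ H₃ → Encloses H₃ u e → edgeLength N ≤ edgeLength e
      N-shortest (x , y) m enc with ∈H₃⁻ m
      ... | inj₁ refl = ≤-refl
      ... | inj₂ (m' , _ , _) with enc v u→v
      ...   | x<v , v<y with <-cmp y (suc v)
      ...     | tri< y<v+1 _ _ = ⊥-elim (<-irrefl refl (<-≤-trans v<y (≤-pred y<v+1)))
      ...     | tri> _ _ v+1<y =
        ⊥-elim (<-asym x<v (≤-pred (subst (suc v <_) (sym (unitBeyond m' (≤-<-trans (s≤s c≤v) v+1<y))) v+1<y)))
      ...     | tri≈ _ refl _ with <-cmp a x
      ...       | tri< a<x _ _  = ⊥-elim (noncrossing A∈ m' a<x x<v (n<1+n v))
      ...       | tri≈ _ refl _ = ≤-refl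
      ...       | tri> _ _ x<a  = ∸-monoʳ-≤ (suc v) (<⇒≤ x<a)

      shortest-at-a : ShortestEnclosingAt H₃ u a
      shortest-at-a = N , here refl , N-encloses , refl , N-shortest

      starts-at-a : ∀ {i} → ShortestEnclosingAt H₃ u i → i ≡ a
      starts-at-a (e , e∈ , enc , refl , min) =
        cong proj₁ (enclosing-unique (Shape.noncrossing shape₃) e N e∈ (here refl) enc N-encloses
                      (≤-antisym (min N (here refl) N-encloses) (N-shortest e e∈ enc)))

    C₃ : List ℕ
    C₃ = component H₃ n v

    u₀ : ℕ
    u₀ = min v C₃

    v→u₀ : Walk H₃ v u₀
    v→u₀ with argmin-sel (λ x → x) v C₃
    ... | inj₁ u₀≡v = subst (Walk H₃ v) (sym u₀≡v) []
    ... | inj₂ u₀∈C = Components.component-sound H₃ n v u₀∈C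

    u₀-below : ∀ {z} → Walk H₃ v z → u₀ ≤ z
    u₀-below p = All.lookup (min≤xs v C₃) (Components.component-complete H₃ n shape₃-onVertices v∈ p)

    u₀∈ : u₀ ∈ vertices n
    u₀∈ = let a<u₀ , u₀≤v = v-side v→u₀ in
      ∈-vertices⁺ (≤-trans 1≤a (<⇒≤ a<u₀)) (≤-trans u₀≤v (≤-trans (n≤1+n v) v+1≤n))

    u₀-counted : Counted H₃ u₀ a
    u₀-counted = (λ w p → u₀-below (v→u₀ ++ʷ p)) , ComponentOfV.shortest-at-a (reverse v→u₀)

    -- in H every vertex reaching v also reaches n along the path tail, so it
    -- is enclosed by no edge
    reaches-n : ∀ {u i} → Walk H u v → ¬ Counted H u i
    reaches-n p (_ , s) = unenclosed (p ++ʷ unitPath H (≤-trans (n≤1+n v) v+1≤n) (λ w v≤w → pathTail w (≤-trans c≤v v≤w))) s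

    is-u₀ : ∀ {u} → Walk H₃ u v → Least H₃ u → u ≡ u₀
    is-u₀ p l = ≤-antisym (l u₀ (p ++ʷ v→u₀)) (u₀-below (reverse p))

    -- away from v, H₃ is H with A exchanged for N
    module AwayFromV {u} (u↛v : ¬ Walk H u v) = Exchange H H₃ u noncrossing (Shape.noncrossing shape₃)
      (avoiding-v u↛v) H₃→H ∈H₃⁻' ∈H⇒H₃ A∈ (here refl) (⊥-elim ∘ u↛v)

    counted⇒ : ∀ {u i} → u ∈ vertices n → Counted H u i → Counted H₃ u i
    counted⇒ u∈ cnt with walk? H n v onVertices u∈
    ... | inj₁ u→v = ⊥-elim (reaches-n u→v cnt)
    ... | inj₂ u↛v = AwayFromV.counted⇒ u↛v cnt

    counted⇐ : ∀ {u i} → u ∈ vertices n → Counted H₃ u i → Counted H u i ⊎ (i ≡ a × u ≡ u₀)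
    counted⇐ u∈ cnt with walk? H n v onVertices u∈
    ... | inj₂ u↛v = inj₁ (AwayFromV.counted⇐ u↛v cnt)
    ... | inj₁ u→v with split-at-v u→v | cnt
    ...   | inj₂ (inj₂ u→v+1) | _ , s = ⊥-elim (ShapeFacts.unenclosed shape₃
                                   (u→v+1 ++ʷ unitPath H₃ v+1≤n (Shape.pathTail shape₃)) s)
    ...   | inj₁ u→v₃        | l , s = inj₂ (ComponentOfV.starts-at-a u→v₃ s , is-u₀ u→v₃ l)
    ...   | inj₂ (inj₁ u→v₃) | l , s = inj₂ (ComponentOfV.starts-at-a u→v₃ s , is-u₀ u→v₃ l)

    f-middle-other : ∀ i → i ≢ a → f H₃ n i ≡ f H n i
    f-middle-other i i≢a = f-cong i shape₃-onVertices onVertices from counted⇒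
      where
        from : ∀ {u} → u ∈ vertices n → Counted H₃ u i → Counted H u i
        from u∈ cnt with counted⇐ u∈ cnt
        ... | inj₁ cnt'         = cnt'
        ... | inj₂ (i≡a , _) = ⊥-elim (i≢a i≡a)

    f-middle-a : f H₃ n a ≡ suc (f H n a)
    f-middle-a = length-filterᵇ-suc (counted? H n a) (counted? H₃ n a) (vertices n) (unique-vertices n) u₀∈
      (Equivalence.to T-≡ (CountedSpec.counted⁺ H₃ n shape₃-onVertices u₀∈ u₀-counted))
      (¬T⇒false (reaches-n (H₃→H (reverse v→u₀)) ∘ CountedSpec.counted⁻ H n onVertices u₀∈))
      λ u u∈ u≢u₀ → counted?-cong a onVertices shape₃-onVertices u∈ (counted⇒ u∈) (from u∈ u≢u₀)
      where
        from : ∀ {u} → u ∈ vertices n → u ≢ u₀ → Counted H₃ u a → Counted H u a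
        from u∈ u≢u₀ cnt with counted⇐ u∈ cnt
        ... | inj₁ cnt'         = cnt'
        ... | inj₂ (_ , u≡u₀) = ⊥-elim (u≢u₀ u≡u₀)

-- Along a path of R^𝒪, count i ms + f H n i is constant

count-here : ∀ a ms → count a (a ∷ ms) ≡ suc (count a ms)
count-here a ms rewrite Equivalence.to T-≡ (≡⇒≡ᵇ a a refl) = refl

count-other : ∀ i a ms → i ≢ a → count i (a ∷ ms) ≡ count i ms
count-other i a ms i≢a rewrite ¬T⇒false (i≢a ∘ ≡ᵇ⇒≡ i a) = refl

middle-step : ∀ {n H c a v} (S : Shape n H c) (R : OReduction H a v (suc v)) ms i →
              count i (a ∷ ms) + f H n i ≡ count i ms + f (Reduction.H₃ S R) n i
middle-step {n} {H} {a = a} S R ms i with i ≟ a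
... | yes refl = begin
  count a (a ∷ ms) + f H n a           ≡⟨ cong (_+ f H n a) (count-here a ms) ⟩
  suc (count a ms) + f H n a           ≡⟨ sym (+-suc (count a ms) (f H n a)) ⟩
  count a ms + suc (f H n a)           ≡⟨ cong (count a ms +_) (sym (Counting.Middle.f-middle-a S R)) ⟩
  count a ms + f (Reduction.H₃ S R) n a ∎
  where open ≡-Reasoning
... | no i≢a = cong₂ _+_ (count-other i a ms i≢a) (sym (Counting.Middle.f-middle-other S R i i≢a))

conserved : ∀ {n H G ms c} → Shape n H c → OPath H G ms → ∀ i → count i ms + f H n i ≡ f G n i
conserved S (leaf _) i = refl
conserved S (left {ms = ms} R P) i with ShapeFacts.reduction-unit S R
... | refl = trans (cong (count i ms +_) (sym (Counting.f-left S R i))) (conserved (Reduction.shape₁ S R) P i)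
conserved S (right {ms = ms} R P) i with ShapeFacts.reduction-unit S R
... | refl = trans (cong (count i ms +_) (sym (Counting.f-right S R i))) (conserved (Reduction.shape₂ S R) P i)
conserved S (mid {ms = ms} R P) i with ShapeFacts.reduction-unit S R
... | refl = trans (middle-step S R ms i) (conserved (Reduction.shape₃ S R) P i)

theorem11 : (n : ℕ) (G : Graph) (ms : List ℕ) → OPath (pathGraph n) G ms →
            (i : ℕ) → 1 ≤ i → i ≤ n ∸ 1 → count i ms ≡ f G n i
theorem11 n G ms P i _ _ = begin
  count i ms                     ≡⟨ sym (+-identityʳ (count i ms)) ⟩
  count i ms + 0                 ≡⟨ cong (count i ms +_) (sym (PathGraph.f-path n i)) ⟩
  count i ms + f (pathGraph n) n i ≡⟨ conserved (PathGraph.shape n) P i ⟩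
  f G n i ∎
  where open ≡-Reasoning
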